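{- Let $F,G\colon\mathbb{F}_2^n\to\mathbb{F}_2^n$ be cyclic bijections that are affine equivalent, and suppose $F$ is affine. Then $F$ and $G$ are cyclically equivalent.
   Context: $S$ is the right cyclic shift on $\mathbb{F}_2^n$. The cycle of $x$ is $c(x)=\{S^j(x):j\in\mathbb{Z}\}$; a map is cyclic if it maps every cycle into a cycle; a matrix $A$ is cyclic if $x\mapsto Ax$ is cyclic (equivalently $AS=S^kA$ for some $1\le k\le n$). $F$ and $G$ are affine equivalent if there exist invertible matrices $A,B$ over $\mathbb{F}_2$ and $d,e\in\mathbb{F}_2^n$ with $F(Ax+e)=BG(x)+d$ for all $x$. $F$ and $G$ are cyclically equivalent if there exist invertible cyclic matrices $A,B$ and $d,e\in\{(0,\dotsc,0),(1,\dotsc,1)\}$ with $F(Ax+e)=BG(x)+d$ for all $x$. -}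

module Defs where

open import Data.Bool using (Bool; true; false; _xor_; _∧_)
open import Data.Nat using (ℕ; zero; suc)
open import Data.Integer using (ℤ; +_; -[1+_])
open import Data.Fin using (Fin; _≟_)
open import Data.Vec using (Vec; []; _∷_; _∷ʳ_; map; zipWith; foldr; replicate; tabulate; transpose)
open import Data.Product using (Σ; ∃; _×_; _,_)
open import Data.Sum using (_⊎_)
open import Relation.Nullary.Decidable using (⌊_⌋)
open import Relation.Binary.PropositionalEquality using (_≡_)
open import Function using (_∘_)

-- Elements of F₂ⁿ: bit vectors (x₁,…,xₙ); false = 0, true = 1, addition = xor.
Bits : ℕ → Set
Bits n = Vec Bool n

_⊕_ : ∀ {n} → Bits n → Bits n → Bits n
_⊕_ = zipWith _xor_

zeros ones : ∀ n → Bits n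
zeros n = replicate n false
ones  n = replicate n true

-- Right cyclic shift S(x₁,…,xₙ) = (xₙ,x₁,…,xₙ₋₁), and its inverse (left shift).
-- Defined via: shL (x ∷ xs) = xs ∷ʳ x ; shR is the inverse.
snocLast : ∀ {n} → Bits (suc n) → Bits n × Bool
snocLast {zero} (x ∷ []) = [] , x
snocLast {suc n} (x ∷ xs) with snocLast xs
... | ys , y = (x ∷ ys) , y

S : ∀ {n} → Bits n → Bits n
S {zero} [] = []
S {suc n} xs with snocLast xs
... | ys , y = y ∷ ys

S⁻¹ : ∀ {n} → Bits n → Bits n
S⁻¹ [] = []
S⁻¹ (x ∷ xs) = xs ∷ʳ x

iter : ∀ {A : Set} → (A → A) → ℕ → A → A
iter f zero x = x
iter f (suc k) x = f (iter f k x)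

Spow : ∀ {n} → ℤ → Bits n → Bits n
Spow (+ k) = iter S k
Spow -[1+ k ] = iter S⁻¹ (suc k)

_∈c_ : ∀ {n} → Bits n → Bits n → Set
y ∈c x = Σ ℤ λ j → y ≡ Spow j x

IsCyclicMap : ∀ {n} → (Bits n → Bits n) → Set
IsCyclicMap {n} F = (x : Bits n) → Σ (Bits n) λ z → (y : Bits n) → y ∈c x → F y ∈c z

-- n×n matrices over F₂, as lists of rows
Mat : ℕ → Set
Mat n = Vec (Vec Bool n) n

dot : ∀ {n} → Bits n → Bits n → Bool
dot u v = foldr _ _xor_ false (zipWith _∧_ u v)

_·_ : ∀ {n} → Mat n → Bits n → Bits n
A · x = map (λ r → dot r x) A

_⊗_ : ∀ {n} → Mat n → Mat n → Mat n
A ⊗ B = map (λ r → map (λ c → dot r c) (transpose B)) A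

I : ∀ n → Mat n
I n = tabulate λ i → tabulate λ j → ⌊ i ≟ j ⌋

Invertible : ∀ {n} → Mat n → Set
Invertible {n} A = Σ (Mat n) λ B → (A ⊗ B ≡ I n) × (B ⊗ A ≡ I n)

IsCyclicMat : ∀ {n} → Mat n → Set
IsCyclicMat A = IsCyclicMap (A ·_)

IsAffine : ∀ {n} → (Bits n → Bits n) → Set
IsAffine {n} F = Σ (Mat n) λ A → Σ (Bits n) λ b → (x : Bits n) → F x ≡ (A · x) ⊕ b

AffineEquivalent : ∀ {n} → (Bits n → Bits n) → (Bits n → Bits n) → Set
AffineEquivalent {n} F G =
  Σ (Mat n) λ A → Σ (Mat n) λ B → Σ (Bits n) λ d → Σ (Bits n) λ e →
    Invertible A × Invertible B ×
    ((x : Bits n) → F ((A · x) ⊕ e) ≡ (B · G x) ⊕ d)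

IsConst : ∀ {n} → Bits n → Set
IsConst {n} d = (d ≡ zeros n) ⊎ (d ≡ ones n)

CyclicallyEquivalent : ∀ {n} → (Bits n → Bits n) → (Bits n → Bits n) → Set
CyclicallyEquivalent {n} F G =
  Σ (Mat n) λ A → Σ (Mat n) λ B → Σ (Bits n) λ d → Σ (Bits n) λ e →
    Invertible A × Invertible B × IsCyclicMat A × IsCyclicMat B ×
    IsConst d × IsConst e ×
    ((x : Bits n) → F ((A · x) ⊕ e) ≡ (B · G x) ⊕ d)

-- An affine map x ↦ P x ⊕ c on F₂ⁿ that is a cyclic bijection has a constant translation
-- part: a cyclic injection reflects fixed points of S, so the bijection permutes the two
-- fixed points 0 and 1, and c = H 0 is one of them. Adding a constant vector commutes with
-- S, so x ↦ P x is cyclic as well, and P is invertible because x ↦ P x is bijective.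
-- Affine equivalence preserves affineness, so G x = N x ⊕ c too; then
-- F (N x ⊕ c) = F (G x) = M (G x) ⊕ b is the required cyclic equivalence.
module Submission where

open import Defs
open import Data.Nat using (ℕ; zero; suc)
open import Function.Definitions using (Bijective; Injective)

open import Algebra.Bundles using (CommutativeRing)
open import Data.Bool using (Bool; true; false; _xor_; _∧_)
open import Data.Bool.Properties
  using (xor-assoc; xor-identityˡ; xor-identityʳ; xor-same; ∧-comm; ∧-assoc; ∧-zeroʳ;
         ∧-distribˡ-xor; xor-∧-commutativeRing)
open import Algebra.Properties.CommutativeSemigroup
  (CommutativeRing.+-commutativeSemigroup xor-∧-commutativeRing) using (interchange)
open import Data.Integer using (ℤ; +_; -[1+_])
open import Data.Fin using (Fin; zero; suc; _≟_)
open import Data.Vec using (Vec; []; _∷_; _∷ʳ_; map; zipWith; replicate; tabulate; transpose; lookup)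
open import Data.Vec.Properties
  using (lookup-map; lookup-replicate; lookup∘tabulate; tabulate∘lookup; tabulate-cong; map-cong;
         map-∘; map-const; map-replicate; zipWith-assoc; zipWith-identityˡ; zipWith-identityʳ;
         zipWith-is-⊛; lookup-zipWith; ∷-injectiveˡ; ∷-injectiveʳ)
open import Data.Product using (Σ; _×_; _,_; proj₁; proj₂)
open import Data.Sum using (inj₁; inj₂)
open import Function using (_∘_)
open import Relation.Binary.PropositionalEquality
  using (_≡_; refl; sym; trans; cong; cong₂; subst; _≗_; module ≡-Reasoning)
open import Relation.Nullary.Decidable using (⌊_⌋; ⌊⌋-map′)

open ≡-Reasoning

private
  variable
    n : ℕ

lookup-ext : ∀ {A : Set} {m} (u v : Vec A m) → (∀ i → lookup u i ≡ lookup v i) → u ≡ v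
lookup-ext u v u≗v = begin
  u                   ≡⟨ tabulate∘lookup u ⟨
  tabulate (lookup u) ≡⟨ tabulate-cong u≗v ⟩
  tabulate (lookup v) ≡⟨ tabulate∘lookup v ⟩
  v                   ∎

⊕-assoc : (u v w : Bits n) → (u ⊕ v) ⊕ w ≡ u ⊕ (v ⊕ w)
⊕-assoc = zipWith-assoc xor-assoc

⊕-self : (u : Bits n) → u ⊕ u ≡ zeros n
⊕-self []      = refl
⊕-self (a ∷ u) = cong₂ _∷_ (xor-same a) (⊕-self u)

⊕-cancelʳ : (u v : Bits n) → (u ⊕ v) ⊕ v ≡ u
⊕-cancelʳ u v = begin
  (u ⊕ v) ⊕ v   ≡⟨ ⊕-assoc u v v ⟩
  u ⊕ (v ⊕ v)   ≡⟨ cong (u ⊕_) (⊕-self v) ⟩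
  u ⊕ zeros _   ≡⟨ zipWith-identityʳ xor-identityʳ u ⟩
  u             ∎

zipWith-∷ʳ : ∀ {A B C : Set} {m} (f : A → B → C) (u : Vec A m) (v : Vec B m) a b →
  zipWith f (u ∷ʳ a) (v ∷ʳ b) ≡ zipWith f u v ∷ʳ f a b
zipWith-∷ʳ f []      []      a b = refl
zipWith-∷ʳ f (x ∷ u) (y ∷ v) a b = cong (f x y ∷_) (zipWith-∷ʳ f u v a b)

dot-comm : (u v : Bits n) → dot u v ≡ dot v u
dot-comm []      []      = refl
dot-comm (a ∷ u) (b ∷ v) = cong₂ _xor_ (∧-comm a b) (dot-comm u v)

dot-zerosˡ : (x : Bits n) → dot (zeros n) x ≡ false
dot-zerosˡ []      = refl
dot-zerosˡ (_ ∷ x) = dot-zerosˡ x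

dot-zerosʳ : (r : Bits n) → dot r (zeros n) ≡ false
dot-zerosʳ r = trans (dot-comm r _) (dot-zerosˡ r)

dot-⊕ʳ : (r u v : Bits n) → dot r (u ⊕ v) ≡ dot r u xor dot r v
dot-⊕ʳ []      []      []      = refl
dot-⊕ʳ (a ∷ r) (b ∷ u) (c ∷ v) = begin
  (a ∧ (b xor c)) xor dot r (u ⊕ v)
    ≡⟨ cong₂ _xor_ (∧-distribˡ-xor a b c) (dot-⊕ʳ r u v) ⟩
  ((a ∧ b) xor (a ∧ c)) xor (dot r u xor dot r v)
    ≡⟨ interchange (a ∧ b) (a ∧ c) (dot r u) (dot r v) ⟩
  ((a ∧ b) xor dot r u) xor ((a ∧ c) xor dot r v) ∎

dot-⊕ˡ : (u v x : Bits n) → dot (u ⊕ v) x ≡ dot u x xor dot v x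
dot-⊕ˡ u v x = begin
  dot (u ⊕ v) x           ≡⟨ dot-comm (u ⊕ v) x ⟩
  dot x (u ⊕ v)           ≡⟨ dot-⊕ʳ x u v ⟩
  dot x u xor dot x v     ≡⟨ cong₂ _xor_ (dot-comm x u) (dot-comm x v) ⟩
  dot u x xor dot v x     ∎

dot-∧ˡ : ∀ a (s x : Bits n) → dot (map (a ∧_) s) x ≡ a ∧ dot s x
dot-∧ˡ a []      []      = sym (∧-zeroʳ a)
dot-∧ˡ a (b ∷ s) (c ∷ x) = begin
  ((a ∧ b) ∧ c) xor dot (map (a ∧_) s) x ≡⟨ cong₂ _xor_ (∧-assoc a b c) (dot-∧ˡ a s x) ⟩
  (a ∧ (b ∧ c)) xor (a ∧ dot s x)       ≡⟨ ∧-distribˡ-xor a (b ∧ c) (dot s x) ⟨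
  a ∧ ((b ∧ c) xor dot s x)             ∎

dot-transpose : ∀ {m k} (r : Bits m) (B : Vec (Bits k) m) (x : Bits k) →
  dot (map (dot r) (transpose B)) x ≡ dot r (map (λ s → dot s x) B)
dot-transpose []      []      x = trans (cong (λ t → dot t x) (map-replicate (dot []) [] _)) (dot-zerosˡ x)
dot-transpose (a ∷ r) (s ∷ B) x = begin
  dot (map (dot (a ∷ r)) (transpose (s ∷ B))) x
    ≡⟨ cong (λ t → dot (map (dot (a ∷ r)) t) x) (zipWith-is-⊛ _∷_ s (transpose B)) ⟨
  dot (map (dot (a ∷ r)) (zipWith _∷_ s (transpose B))) x
    ≡⟨ cong (λ t → dot t x) (map-dot-∷ s (transpose B)) ⟩
  dot (map (a ∧_) s ⊕ map (dot r) (transpose B)) x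
    ≡⟨ dot-⊕ˡ (map (a ∧_) s) (map (dot r) (transpose B)) x ⟩
  dot (map (a ∧_) s) x xor dot (map (dot r) (transpose B)) x
    ≡⟨ cong₂ _xor_ (dot-∧ˡ a s x) (dot-transpose r B x) ⟩
  (a ∧ dot s x) xor dot r (map (λ s → dot s x) B) ∎
  where
  map-dot-∷ : ∀ {l} (s : Bits l) (T : Vec (Bits _) l) →
    map (dot (a ∷ r)) (zipWith _∷_ s T) ≡ map (a ∧_) s ⊕ map (dot r) T
  map-dot-∷ []      []      = refl
  map-dot-∷ (b ∷ s) (t ∷ T) = cong (_ ∷_) (map-dot-∷ s T)

lookup-· : (P : Mat n) (x : Bits n) (i : Fin n) → lookup (P · x) i ≡ dot (lookup P i) x
lookup-· P x i = lookup-map i (λ r → dot r x) P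

·-⊗ : (P Q : Mat n) (x : Bits n) → (P ⊗ Q) · x ≡ P · (Q · x)
·-⊗ P Q x = trans (sym (map-∘ _ _ P)) (map-cong (λ r → dot-transpose r Q x) P)

·-⊕ : (P : Mat n) (u v : Bits n) → P · (u ⊕ v) ≡ (P · u) ⊕ (P · v)
·-⊕ P u v = lookup-ext _ _ λ i → begin
  lookup (P · (u ⊕ v)) i                    ≡⟨ lookup-· P (u ⊕ v) i ⟩
  dot (lookup P i) (u ⊕ v)                  ≡⟨ dot-⊕ʳ (lookup P i) u v ⟩
  dot (lookup P i) u xor dot (lookup P i) v ≡⟨ cong₂ _xor_ (lookup-· P u i) (lookup-· P v i) ⟨
  lookup (P · u) i xor lookup (P · v) i     ≡⟨ lookup-zipWith _xor_ i (P · u) (P · v) ⟨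
  lookup ((P · u) ⊕ (P · v)) i              ∎

·-zeros : (P : Mat n) → P · zeros n ≡ zeros n
·-zeros P = trans (map-cong dot-zerosʳ P) (map-const P false)

basis : Fin n → Bits n
basis i = tabulate λ j → ⌊ i ≟ j ⌋

dot-basisˡ : (i : Fin n) (x : Bits n) → dot (basis i) x ≡ lookup x i
dot-basisˡ zero    (a ∷ x) = begin
  a xor dot (tabulate λ _ → false) x ≡⟨ cong (λ t → a xor dot t x) tabulate-false ⟩
  a xor dot (zeros _) x              ≡⟨ cong (a xor_) (dot-zerosˡ x) ⟩
  a xor false                        ≡⟨ xor-identityʳ a ⟩
  a                                  ∎
  where
  tabulate-false : tabulate (λ _ → false) ≡ zeros _
  tabulate-false = trans (tabulate-cong λ i → sym (lookup-replicate i false)) (tabulate∘lookup _)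
dot-basisˡ (suc i) (a ∷ x) = begin
  dot (tabulate λ j → ⌊ suc i ≟ suc j ⌋) x ≡⟨ cong (λ t → dot t x) (tabulate-cong λ j → ⌊⌋-map′ _ _ (i ≟ j)) ⟩
  dot (basis i) x                          ≡⟨ dot-basisˡ i x ⟩
  lookup x i                               ∎

·-identityˡ : (x : Bits n) → I n · x ≡ x
·-identityˡ {n} x = lookup-ext _ _ λ i → begin
  lookup (I n · x) i     ≡⟨ lookup-· (I n) x i ⟩
  dot (lookup (I n) i) x ≡⟨ cong (λ r → dot r x) (lookup∘tabulate basis i) ⟩
  dot (basis i) x        ≡⟨ dot-basisˡ i x ⟩
  lookup x i             ∎

lookup-·-basis : (P : Mat n) (i j : Fin n) → lookup (P · basis j) i ≡ lookup (lookup P i) j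
lookup-·-basis P i j = begin
  lookup (P · basis j) i       ≡⟨ lookup-· P (basis j) i ⟩
  dot (lookup P i) (basis j)   ≡⟨ dot-comm (lookup P i) (basis j) ⟩
  dot (basis j) (lookup P i)   ≡⟨ dot-basisˡ j (lookup P i) ⟩
  lookup (lookup P i) j        ∎

matrix-ext : (P Q : Mat n) → (∀ j → P · basis j ≡ Q · basis j) → P ≡ Q
matrix-ext P Q P≗Q = lookup-ext P Q λ i → lookup-ext _ _ λ j → begin
  lookup (lookup P i) j  ≡⟨ lookup-·-basis P i j ⟨
  lookup (P · basis j) i ≡⟨ cong (λ v → lookup v i) (P≗Q j) ⟩
  lookup (Q · basis j) i ≡⟨ lookup-·-basis Q i j ⟩
  lookup (lookup Q i) j  ∎

matrixOf : (Bits n → Bits n) → Mat n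
matrixOf g = tabulate λ i → tabulate λ j → lookup (g (basis j)) i

matrixOf-basis : (g : Bits n → Bits n) (j : Fin n) → matrixOf g · basis j ≡ g (basis j)
matrixOf-basis g j = lookup-ext _ _ λ i → begin
  lookup (matrixOf g · basis j) i                  ≡⟨ lookup-·-basis (matrixOf g) i j ⟩
  lookup (lookup (matrixOf g) i) j                 ≡⟨ cong (λ r → lookup r j) (lookup∘tabulate _ i) ⟩
  lookup (tabulate λ j → lookup (g (basis j)) i) j ≡⟨ lookup∘tabulate _ j ⟩
  lookup (g (basis j)) i                           ∎

-- The inverse is the matrix of the (automatically linear) inverse map, so only its
-- values on the basis matter.
bijective⇒invertible : (P : Mat n) → Bijective _≡_ _≡_ (P ·_) → Invertible P
bijective⇒invertible {n} P (inj , surj) = X , P⊗X≡I , X⊗P≡I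
  where
  g : Bits n → Bits n
  g y = proj₁ (surj y)
  X : Mat n
  X = matrixOf g
  P⊗X≡I : P ⊗ X ≡ I n
  P⊗X≡I = matrix-ext _ _ λ j → begin
    (P ⊗ X) · basis j ≡⟨ ·-⊗ P X (basis j) ⟩
    P · (X · basis j) ≡⟨ cong (P ·_) (matrixOf-basis g j) ⟩
    P · g (basis j)   ≡⟨ proj₂ (surj (basis j)) refl ⟩
    basis j           ≡⟨ ·-identityˡ (basis j) ⟨
    I n · basis j     ∎
  X⊗P≡I : X ⊗ P ≡ I n
  X⊗P≡I = matrix-ext _ _ λ j → inj (begin
    P · ((X ⊗ P) · basis j) ≡⟨ cong (P ·_) (·-⊗ X P (basis j)) ⟩
    P · (X · (P · basis j)) ≡⟨ ·-⊗ P X (P · basis j) ⟨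
    (P ⊗ X) · (P · basis j) ≡⟨ cong (_· (P · basis j)) P⊗X≡I ⟩
    I n · (P · basis j)     ≡⟨ ·-identityˡ (P · basis j) ⟩
    P · basis j             ≡⟨ cong (P ·_) (·-identityˡ (basis j)) ⟨
    P · (I n · basis j)     ∎)

IsAffine-resp-≗ : {f g : Bits n → Bits n} → f ≗ g → IsAffine f → IsAffine g
IsAffine-resp-≗ f≗g (P , c , f≡) = P , c , λ x → trans (sym (f≗g x)) (f≡ x)

IsAffine-∘ : {f g : Bits n → Bits n} → IsAffine f → IsAffine g → IsAffine (f ∘ g)
IsAffine-∘ {f = f} {g} (P , c , f≡) (Q , d , g≡) = P ⊗ Q , (P · d) ⊕ c , λ x → begin
  f (g x)                          ≡⟨ f≡ (g x) ⟩
  (P · g x) ⊕ c                    ≡⟨ cong (λ y → (P · y) ⊕ c) (g≡ x) ⟩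
  (P · ((Q · x) ⊕ d)) ⊕ c          ≡⟨ cong (_⊕ c) (·-⊕ P (Q · x) d) ⟩
  ((P · (Q · x)) ⊕ (P · d)) ⊕ c    ≡⟨ ⊕-assoc (P · (Q · x)) (P · d) c ⟩
  (P · (Q · x)) ⊕ ((P · d) ⊕ c)    ≡⟨ cong (_⊕ ((P · d) ⊕ c)) (·-⊗ P Q x) ⟨
  ((P ⊗ Q) · x) ⊕ ((P · d) ⊕ c)    ∎

AffineEquivalent⇒IsAffine : {F G : Bits n → Bits n} → AffineEquivalent F G → IsAffine F → IsAffine G
AffineEquivalent⇒IsAffine {n} {F} {G} (A , B , d , e , _ , (B⁻¹ , _ , B⁻¹⊗B≡I) , F∘A≡B∘G) F-affine =
  IsAffine-resp-≗ B⁻¹∘F∘A≗G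
    (IsAffine-∘ (B⁻¹ , B⁻¹ · d , λ y → ·-⊕ B⁻¹ y d) (IsAffine-∘ F-affine (A , e , λ _ → refl)))
  where
  B⁻¹∘F∘A≗G : (λ x → B⁻¹ · (F ((A · x) ⊕ e) ⊕ d)) ≗ G
  B⁻¹∘F∘A≗G x = begin
    B⁻¹ · (F ((A · x) ⊕ e) ⊕ d)   ≡⟨ cong (λ y → B⁻¹ · (y ⊕ d)) (F∘A≡B∘G x) ⟩
    B⁻¹ · (((B · G x) ⊕ d) ⊕ d)   ≡⟨ cong (B⁻¹ ·_) (⊕-cancelʳ (B · G x) d) ⟩
    B⁻¹ · (B · G x)               ≡⟨ ·-⊗ B⁻¹ B (G x) ⟨
    (B⁻¹ ⊗ B) · G x               ≡⟨ cong (_· G x) B⁻¹⊗B≡I ⟩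
    I n · G x                     ≡⟨ ·-identityˡ (G x) ⟩
    G x                           ∎

∷ʳ-snocLast : (xs : Bits (suc n)) → proj₁ (snocLast xs) ∷ʳ proj₂ (snocLast xs) ≡ xs
∷ʳ-snocLast {zero}  (x ∷ []) = refl
∷ʳ-snocLast {suc n} (x ∷ xs) = cong (x ∷_) (∷ʳ-snocLast xs)

snocLast-∷ʳ : (ys : Bits n) (y : Bool) → snocLast (ys ∷ʳ y) ≡ (ys , y)
snocLast-∷ʳ []       y = refl
snocLast-∷ʳ (x ∷ ys) y = cong (λ p → (x ∷ proj₁ p) , proj₂ p) (snocLast-∷ʳ ys y)

S⁻¹∘S : (x : Bits n) → S⁻¹ (S x) ≡ x
S⁻¹∘S {zero}  [] = refl
S⁻¹∘S {suc n} x  = ∷ʳ-snocLast x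

S∘S⁻¹ : (x : Bits n) → S (S⁻¹ x) ≡ x
S∘S⁻¹ []       = refl
S∘S⁻¹ (a ∷ xs) = cong (λ p → proj₂ p ∷ proj₁ p) (snocLast-∷ʳ xs a)

S-injective : Injective _≡_ _≡_ (S {n})
S-injective {x = x} {y} Sx≡Sy = trans (sym (S⁻¹∘S x)) (trans (cong S⁻¹ Sx≡Sy) (S⁻¹∘S y))

S⁻¹-injective : Injective _≡_ _≡_ (S⁻¹ {n})
S⁻¹-injective {x = x} {y} S⁻¹x≡S⁻¹y = trans (sym (S∘S⁻¹ x)) (trans (cong S S⁻¹x≡S⁻¹y) (S∘S⁻¹ y))

S⁻¹-⊕ : (u v : Bits n) → S⁻¹ (u ⊕ v) ≡ S⁻¹ u ⊕ S⁻¹ v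
S⁻¹-⊕ []      []      = refl
S⁻¹-⊕ (a ∷ u) (b ∷ v) = sym (zipWith-∷ʳ _xor_ u v a b)

S-⊕ : (u v : Bits n) → S (u ⊕ v) ≡ S u ⊕ S v
S-⊕ u v = S⁻¹-injective (begin
  S⁻¹ (S (u ⊕ v))             ≡⟨ S⁻¹∘S (u ⊕ v) ⟩
  u ⊕ v                       ≡⟨ cong₂ _⊕_ (S⁻¹∘S u) (S⁻¹∘S v) ⟨
  S⁻¹ (S u) ⊕ S⁻¹ (S v)       ≡⟨ S⁻¹-⊕ (S u) (S v) ⟨
  S⁻¹ (S u ⊕ S v)             ∎)

Fixed : Bits n → Set
Fixed x = S x ≡ x

Fixed-S⁻¹ : {x : Bits n} → Fixed x → S⁻¹ x ≡ x
Fixed-S⁻¹ {x = x} Sx≡x = trans (cong S⁻¹ (sym Sx≡x)) (S⁻¹∘S x)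

replicate-fixed : ∀ n (a : Bool) → Fixed (replicate n a)
replicate-fixed n a = trans (cong S (sym (S⁻¹-replicate n))) (S∘S⁻¹ _)
  where
  S⁻¹-replicate : ∀ m → S⁻¹ (replicate m a) ≡ replicate m a
  S⁻¹-replicate zero          = refl
  S⁻¹-replicate (suc zero)    = refl
  S⁻¹-replicate (suc (suc m)) = cong (a ∷_) (S⁻¹-replicate (suc m))

IsConst⇒Fixed : {x : Bits n} → IsConst x → Fixed x
IsConst⇒Fixed (inj₁ refl) = replicate-fixed _ false
IsConst⇒Fixed (inj₂ refl) = replicate-fixed _ true

∷ʳ≡∷⇒replicate : (a : Bool) (xs : Bits n) → xs ∷ʳ a ≡ a ∷ xs → xs ≡ replicate n a
∷ʳ≡∷⇒replicate a []       _ = refl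
∷ʳ≡∷⇒replicate a (b ∷ xs) p with ∷-injectiveˡ p
... | refl = cong (b ∷_) (∷ʳ≡∷⇒replicate a xs (∷-injectiveʳ p))

Fixed⇒IsConst : (x : Bits n) → Fixed x → IsConst x
Fixed⇒IsConst []           _    = inj₁ refl
Fixed⇒IsConst (false ∷ xs) Sx≡x = inj₁ (cong (false ∷_) (∷ʳ≡∷⇒replicate false xs (Fixed-S⁻¹ Sx≡x)))
Fixed⇒IsConst (true  ∷ xs) Sx≡x = inj₂ (cong (true ∷_) (∷ʳ≡∷⇒replicate true xs (Fixed-S⁻¹ Sx≡x)))

iter-commute : ∀ {A : Set} (f h : A → A) → (∀ x → f (h x) ≡ h (f x)) →
  ∀ k x → f (iter h k x) ≡ iter h k (f x)
iter-commute f h f∘h≗h∘f zero    x = refl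
iter-commute f h f∘h≗h∘f (suc k) x = trans (f∘h≗h∘f _) (cong h (iter-commute f h f∘h≗h∘f k x))

iter-injective : ∀ {A : Set} (h : A → A) → Injective _≡_ _≡_ h → ∀ k → Injective _≡_ _≡_ (iter h k)
iter-injective h h-inj zero    p = p
iter-injective h h-inj (suc k) p = iter-injective h h-inj k (h-inj p)

iter-fixed : ∀ {A : Set} (h : A → A) {z : A} → h z ≡ z → ∀ k → iter h k z ≡ z
iter-fixed h hz≡z zero    = refl
iter-fixed h hz≡z (suc k) = trans (cong h (iter-fixed h hz≡z k)) hz≡z

iter-homomorphic : ∀ {A : Set} (_∙_ : A → A → A) (h : A → A) → (∀ u v → h (u ∙ v) ≡ h u ∙ h v) →
  ∀ k u v → iter h k (u ∙ v) ≡ iter h k u ∙ iter h k v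
iter-homomorphic _∙_ h h-homo zero    u v = refl
iter-homomorphic _∙_ h h-homo (suc k) u v = trans (cong h (iter-homomorphic _∙_ h h-homo k u v)) (h-homo _ _)

S-Spow : (j : ℤ) (x : Bits n) → S (Spow j x) ≡ Spow j (S x)
S-Spow (+ k)    = iter-commute S S (λ _ → refl) k
S-Spow -[1+ k ] = iter-commute S S⁻¹ (λ y → trans (S∘S⁻¹ y) (sym (S⁻¹∘S y))) (suc k)

Spow-injective : (j : ℤ) → Injective _≡_ _≡_ (Spow {n} j)
Spow-injective (+ k)    = iter-injective S S-injective k
Spow-injective -[1+ k ] = iter-injective S⁻¹ S⁻¹-injective (suc k)

Spow-fixed : (j : ℤ) {z : Bits n} → Fixed z → Spow j z ≡ z
Spow-fixed (+ k)    Sz≡z = iter-fixed S Sz≡z k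
Spow-fixed -[1+ k ] Sz≡z = iter-fixed S⁻¹ (Fixed-S⁻¹ Sz≡z) (suc k)

Spow-⊕ : (j : ℤ) (u v : Bits n) → Spow j (u ⊕ v) ≡ Spow j u ⊕ Spow j v
Spow-⊕ (+ k)    = iter-homomorphic _⊕_ S S-⊕ k
Spow-⊕ -[1+ k ] = iter-homomorphic _⊕_ S⁻¹ S⁻¹-⊕ (suc k)

-- x and S x lie in one cycle, so H x and H (S x) are shifts of one z; if H x is fixed,
-- so is z, hence H (S x) = z = H x.
Fixed-preimage : {H : Bits n → Bits n} → Injective _≡_ _≡_ H → IsCyclicMap H →
  (x : Bits n) → Fixed (H x) → Fixed x
Fixed-preimage {H = H} H-inj H-cyclic x SHx≡Hx with H-cyclic x
... | z , H[cx]⊆cz with H[cx]⊆cz x (+ 0 , refl) | H[cx]⊆cz (S x) (+ 1 , refl)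
... | i , Hx≡Sⁱz | j , HSx≡Sʲz = H-inj (begin
  H (S x)  ≡⟨ HSx≡Sʲz ⟩
  Spow j z ≡⟨ Spow-fixed j Sz≡z ⟩
  z        ≡⟨ Spow-fixed i Sz≡z ⟨
  Spow i z ≡⟨ Hx≡Sⁱz ⟨
  H x      ∎)
  where
  Sz≡z : Fixed z
  Sz≡z = Spow-injective i (begin
    Spow i (S z) ≡⟨ S-Spow i z ⟨
    S (Spow i z) ≡⟨ cong S Hx≡Sⁱz ⟨
    S (H x)      ≡⟨ SHx≡Hx ⟩
    H x          ≡⟨ Hx≡Sⁱz ⟩
    Spow i z     ∎)

IsConst-preimage : {H : Bits n → Bits n} → Injective _≡_ _≡_ H → IsCyclicMap H →
  (x : Bits n) → IsConst (H x) → IsConst x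
IsConst-preimage H-inj H-cyclic x = Fixed⇒IsConst x ∘ Fixed-preimage H-inj H-cyclic x ∘ IsConst⇒Fixed

-- The preimages of 0 and 1 are constant; if 0 ↦ 0 fails then 1 ↦ 0, so 0 ↦ 1
-- (unless 0 = 1, which happens for n = 0).
IsConst-image-zeros : {H : Bits n → Bits n} → Bijective _≡_ _≡_ H → IsCyclicMap H → IsConst (H (zeros n))
IsConst-image-zeros {n} {H} (H-inj , H-surj) H-cyclic =
  cases (IsConst-preimage H-inj H-cyclic y₀ (subst IsConst (sym Hy₀≡0) (inj₁ refl)))
        (IsConst-preimage H-inj H-cyclic y₁ (subst IsConst (sym Hy₁≡1) (inj₂ refl)))
  where
  y₀ y₁ : Bits n
  y₀ = proj₁ (H-surj (zeros n))
  y₁ = proj₁ (H-surj (ones n))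
  Hy₀≡0 : H y₀ ≡ zeros n
  Hy₀≡0 = proj₂ (H-surj (zeros n)) refl
  Hy₁≡1 : H y₁ ≡ ones n
  Hy₁≡1 = proj₂ (H-surj (ones n)) refl
  cases : IsConst y₀ → IsConst y₁ → IsConst (H (zeros n))
  cases (inj₁ y₀≡0) _           = inj₁ (subst (λ y → H y ≡ zeros n) y₀≡0 Hy₀≡0)
  cases (inj₂ _)    (inj₁ y₁≡0) = inj₂ (subst (λ y → H y ≡ ones n) y₁≡0 Hy₁≡1)
  cases (inj₂ y₀≡1) (inj₂ y₁≡1) = inj₁ (begin
    H (zeros n) ≡⟨ cong H 0≡1 ⟩
    H (ones n)  ≡⟨ cong H y₀≡1 ⟨
    H y₀        ≡⟨ Hy₀≡0 ⟩
    zeros n     ∎)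
    where
    0≡1 : zeros n ≡ ones n
    0≡1 = trans (sym Hy₀≡0) (trans (cong H (trans y₀≡1 (sym y₁≡1))) Hy₁≡1)

∈c-⊕-Fixed : {y z c : Bits n} → Fixed c → y ∈c z → (y ⊕ c) ∈c (z ⊕ c)
∈c-⊕-Fixed {y = y} {z} {c} Sc≡c (j , y≡Sʲz) = j , (begin
  y ⊕ c               ≡⟨ cong₂ _⊕_ y≡Sʲz (sym (Spow-fixed j Sc≡c)) ⟩
  Spow j z ⊕ Spow j c ≡⟨ Spow-⊕ j z c ⟨
  Spow j (z ⊕ c)      ∎)

module _ {H : Bits n → Bits n} {P : Mat n} {c : Bits n} (H≡ : ∀ x → H x ≡ (P · x) ⊕ c) where

  private
    P·≡ : ∀ x → P · x ≡ H x ⊕ c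
    P·≡ x = trans (sym (⊕-cancelʳ (P · x) c)) (cong (_⊕ c) (sym (H≡ x)))

  affine-translation-IsConst : Bijective _≡_ _≡_ H → IsCyclicMap H → IsConst c
  affine-translation-IsConst H-bij H-cyclic = subst IsConst H0≡c (IsConst-image-zeros H-bij H-cyclic)
    where
    H0≡c : H (zeros n) ≡ c
    H0≡c = trans (H≡ (zeros n)) (trans (cong (_⊕ c) (·-zeros P)) (zipWith-identityˡ xor-identityˡ c))

  affine-linear-bijective : Bijective _≡_ _≡_ H → Bijective _≡_ _≡_ (P ·_)
  affine-linear-bijective (H-inj , H-surj) = P-inj , P-surj
    where
    P-inj : Injective _≡_ _≡_ (P ·_)
    P-inj {u} {v} Pu≡Pv = H-inj (trans (H≡ u) (trans (cong (_⊕ c) Pu≡Pv) (sym (H≡ v))))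
    P-surj : ∀ y → Σ (Bits n) λ x → ∀ {z} → z ≡ x → P · z ≡ y
    P-surj y = proj₁ (H-surj (y ⊕ c)) , λ { refl →
      trans (P·≡ _) (trans (cong (_⊕ c) (proj₂ (H-surj (y ⊕ c)) refl)) (⊕-cancelʳ y c)) }

  affine-linear-cyclic : Fixed c → IsCyclicMap H → IsCyclicMat P
  affine-linear-cyclic Sc≡c H-cyclic x with H-cyclic x
  ... | z , H[cx]⊆cz = z ⊕ c , λ y y∈cx → subst (_∈c (z ⊕ c)) (sym (P·≡ y)) (∈c-⊕-Fixed Sc≡c (H[cx]⊆cz y y∈cx))

  affine-cyclic-bijection : Bijective _≡_ _≡_ H → IsCyclicMap H → Invertible P × IsCyclicMat P × IsConst c
  affine-cyclic-bijection H-bij H-cyclic =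
    bijective⇒invertible P (affine-linear-bijective H-bij) ,
    affine-linear-cyclic (IsConst⇒Fixed c-const) H-cyclic ,
    c-const
    where
    c-const : IsConst c
    c-const = affine-translation-IsConst H-bij H-cyclic

mainTheorem12 : (n : ℕ) (F G : Bits n → Bits n) →
    Bijective _≡_ _≡_ F → Bijective _≡_ _≡_ G →
    IsCyclicMap F → IsCyclicMap G →
    AffineEquivalent F G → IsAffine F →
    CyclicallyEquivalent F G
mainTheorem12 n F G F-bij G-bij F-cyclic G-cyclic F~G F-affine@(M , b , F≡)
  with AffineEquivalent⇒IsAffine F~G F-affine
... | N , c , G≡
  with affine-cyclic-bijection F≡ F-bij F-cyclic | affine-cyclic-bijection G≡ G-bij G-cyclic
... | M-inv , M-cyclic , b-const | N-inv , N-cyclic , c-const =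
  N , M , b , c , N-inv , M-inv , N-cyclic , M-cyclic , b-const , c-const ,
  λ x → trans (F≡ ((N · x) ⊕ c)) (cong (λ y → (M · y) ⊕ b) (sym (G≡ x)))
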